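{- Let $P=(C,A^\oplus,A^\ominus)$ be a binary pattern graph and let $P'$ result from $P$ by removing an arc $(c_1,c_2)$ from $A^\oplus$ or from $A^\ominus$, where no arc in $A^\oplus\cup A^\ominus$ starts at $c_2$. Then $\mathrm{p\text{ - }saturation}^{\ge}(P)=\mathrm{p\text{ - }saturation}^{\ge}(P')$.
   Context: A basic graph $B=(V,E)$ is a finite undirected graph without self-loops. A binary pattern graph is $P=(C,A^\oplus,A^\ominus)$ with $C=\{\mathrm{black},\mathrm{white}\}$ and $A^\oplus,A^\ominus\subseteq C\times C$. For a coloring $c\colon V\to C$, a witness function is $w\colon V\to V$ with, for all $x$: $x\ne w(x)$; $\{x,w(x)\}\in E\Rightarrow(c(x),c(w(x)))\in A^\oplus$; $\{x,w(x)\}\notin E\Rightarrow(c(x),c(w(x)))\in A^\ominus$. $B$ is $P$-saturated by $c,w$ if $w$ is a witness function for $c$; the weight of $c$ is the number of black vertices. $\mathrm{p\text{ - }saturation}^{\ge}(P)$ is the set of pairs $(B,k)$, $B$ a basic graph, $k\in\mathbb N$, such that $B$ can be $P$-saturated via a coloring of weight at least $k$. -}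

module Defs where

open import Data.Nat using (ℕ; zero; suc; _≤_)
open import Data.Fin using (Fin; zero; suc)
open import Data.Bool using (Bool; true; false; _∧_; not)
open import Data.Product using (Σ; _×_; ∃)
open import Relation.Binary.PropositionalEquality using (_≡_; _≢_)
open import Relation.Nullary using (¬_)

data Color : Set where
  black white : Color

_≟C_ : Color → Color → Bool
black ≟C black = true
white ≟C white = true
_     ≟C _     = false

record BasicGraph : Set where
  field
    n     : ℕ
    adj   : Fin n → Fin n → Bool
    sym   : ∀ x y → adj x y ≡ adj y x
    irrefl : ∀ x → adj x x ≡ false
open BasicGraph public

record PatternGraph : Set where
  field
    A⊕ : Color → Color → Bool
    A⊖ : Color → Color → Bool
open PatternGraph public

data Sign : Set where
  plus minus : Sign

arcs : PatternGraph → Sign → Color → Color → Bool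
arcs P plus  = A⊕ P
arcs P minus = A⊖ P

removeArcRel : (Color → Color → Bool) → Color → Color → Color → Color → Bool
removeArcRel A c₁ c₂ a b = A a b ∧ not ((a ≟C c₁) ∧ (b ≟C c₂))

removeArc : PatternGraph → Sign → Color → Color → PatternGraph
removeArc P plus  c₁ c₂ = record { A⊕ = removeArcRel (A⊕ P) c₁ c₂ ; A⊖ = A⊖ P }
removeArc P minus c₁ c₂ = record { A⊕ = A⊕ P ; A⊖ = removeArcRel (A⊖ P) c₁ c₂ }

IsWitness : (P : PatternGraph) (B : BasicGraph) → (Fin (n B) → Color) → (Fin (n B) → Fin (n B)) → Set
IsWitness P B c w = ∀ x →
  (x ≢ w x)
  × (adj B x (w x) ≡ true  → A⊕ P (c x) (c (w x)) ≡ true)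
  × (adj B x (w x) ≡ false → A⊖ P (c x) (c (w x)) ≡ true)

weight : ∀ {m} → (Fin m → Color) → ℕ
weight {zero}  c = zero
weight {suc m} c with c zero
... | black = suc (weight (λ i → c (suc i)))
... | white = weight (λ i → c (suc i))

PSat≥ : PatternGraph → BasicGraph → ℕ → Set
PSat≥ P B k = Σ (Fin (n B) → Color) λ c → Σ (Fin (n B) → Fin (n B)) λ w →
  IsWitness P B c w × (k ≤ weight c)

-- In a P-saturation every vertex x has an outgoing arc (c x, c (w x)) of P, so no vertex
-- can carry the sink colour c₂.
module Submission where

open import Defs
open import Data.Nat using (ℕ)
open import Data.Bool using (true; false)
open import Data.Bool.Properties using (∧-conicalˡ; ∧-zeroʳ)
open import Data.Fin using (Fin)
open import Data.Product using (_×_; _,_; proj₁; proj₂)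
open import Data.Sum using (_⊎_; inj₁; inj₂)
open import Data.Unit using (⊤)
open import Relation.Binary.PropositionalEquality using (_≡_; _≢_; refl; trans) renaming (sym to ≡-sym)
open import Function.Bundles using (_⇔_; mk⇔)

ArcsIncludedOn : (Color → Set) → PatternGraph → PatternGraph → Set
ArcsIncludedOn R P Q = ∀ a b → R b
  → (A⊕ P a b ≡ true → A⊕ Q a b ≡ true) × (A⊖ P a b ≡ true → A⊖ Q a b ≡ true)

isWitness-transfer : ∀ {R} P Q B {c : Fin (n B) → Color} {w}
  → (∀ y → R (c y)) → ArcsIncludedOn R P Q
  → IsWitness P B c w → IsWitness Q B c w
isWitness-transfer P Q B {c} {w} inR P⊆Q W x with W x
... | x≢wx , ⊕ , ⊖ = x≢wx , (λ e → proj₁ incl (⊕ e)) , (λ e → proj₂ incl (⊖ e))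
  where
  incl : (A⊕ P (c x) (c (w x)) ≡ true → A⊕ Q (c x) (c (w x)) ≡ true)
       × (A⊖ P (c x) (c (w x)) ≡ true → A⊖ Q (c x) (c (w x)) ≡ true)
  incl = P⊆Q (c x) (c (w x)) (inR (w x))

witness-outArc : ∀ P B {c : Fin (n B) → Color} {w}
  → IsWitness P B c w
  → ∀ x → A⊕ P (c x) (c (w x)) ≡ true ⊎ A⊖ P (c x) (c (w x)) ≡ true
witness-outArc P B {w = w} W x with adj B x (w x) | W x
... | true  | _ , ⊕ , _ = inj₁ (⊕ refl)
... | false | _ , _ , ⊖ = inj₂ (⊖ refl)

witness-avoids-sink : ∀ P {c₂} B {c : Fin (n B) → Color} {w}
  → (∀ c → (A⊕ P c₂ c ≡ false) × (A⊖ P c₂ c ≡ false))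
  → IsWitness P B c w → ∀ x → c x ≢ c₂
witness-avoids-sink P B {c} {w} sink W x refl with witness-outArc P B {c} {w} W x
... | inj₁ ⊕ with () ← trans (≡-sym ⊕) (proj₁ (sink (c (w x))))
... | inj₂ ⊖ with () ← trans (≡-sym ⊖) (proj₂ (sink (c (w x))))

pSat≥-transfer : ∀ {R} P Q B k
  → (∀ {c w} → IsWitness P B c w → ∀ y → R (c y)) → ArcsIncludedOn R P Q
  → PSat≥ P B k → PSat≥ Q B k
pSat≥-transfer P Q B k inR P⊆Q (c , w , W , k≤wt) =
  c , w , isWitness-transfer P Q B (inR W) P⊆Q W , k≤wt

≟C-≢ : ∀ {a b} → a ≢ b → (a ≟C b) ≡ false
≟C-≢ {black} {black} a≢b with () ← a≢b refl
≟C-≢ {black} {white} _ = refl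
≟C-≢ {white} {black} _ = refl
≟C-≢ {white} {white} a≢b with () ← a≢b refl

removeArcRel-⊆ : ∀ A c₁ c₂ a b → removeArcRel A c₁ c₂ a b ≡ true → A a b ≡ true
removeArcRel-⊆ A c₁ c₂ a b = ∧-conicalˡ (A a b) _

removeArcRel-⊇ : ∀ A c₁ c₂ a b → b ≢ c₂ → A a b ≡ true → removeArcRel A c₁ c₂ a b ≡ true
removeArcRel-⊇ A c₁ c₂ a b b≢c₂ Aab rewrite Aab | ≟C-≢ b≢c₂ | ∧-zeroʳ (a ≟C c₁) = refl

removeArc-included : ∀ P s c₁ c₂ → ArcsIncludedOn (λ _ → ⊤) (removeArc P s c₁ c₂) P
removeArc-included P plus  c₁ c₂ a b _ = removeArcRel-⊆ (A⊕ P) c₁ c₂ a b , λ e → e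
removeArc-included P minus c₁ c₂ a b _ = (λ e → e) , removeArcRel-⊆ (A⊖ P) c₁ c₂ a b

included-removeArc : ∀ P s c₁ c₂ → ArcsIncludedOn (_≢ c₂) P (removeArc P s c₁ c₂)
included-removeArc P plus  c₁ c₂ a b b≢c₂ = removeArcRel-⊇ (A⊕ P) c₁ c₂ a b b≢c₂ , λ e → e
included-removeArc P minus c₁ c₂ a b b≢c₂ = (λ e → e) , removeArcRel-⊇ (A⊖ P) c₁ c₂ a b b≢c₂

mainTheorem16 : (P : PatternGraph) (s : Sign) (c₁ c₂ : Color)
    → arcs P s c₁ c₂ ≡ true
    → (∀ c → (A⊕ P c₂ c ≡ false) × (A⊖ P c₂ c ≡ false))
    → (B : BasicGraph) (k : ℕ)
    → PSat≥ P B k ⇔ PSat≥ (removeArc P s c₁ c₂) B k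
mainTheorem16 P s c₁ c₂ _ c₂-sink B k = mk⇔
  (pSat≥-transfer P P' B k (witness-avoids-sink P B c₂-sink) (included-removeArc P s c₁ c₂))
  (pSat≥-transfer P' P B k (λ _ _ → _) (removeArc-included P s c₁ c₂))
  where P' = removeArc P s c₁ c₂
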